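{- Let $A$ be a $(0,1,\ast)$-matrix with $n$ columns. If $A$ contains $r$ rows which form an $r$-by-$n$ star-monotone submatrix of min-rank $r$, then $\mathrm{opt}(A)\leq 2^{n-r}$.
   Context: A $(0,1,\ast)$-matrix is a matrix with entries in $\{0,1,\ast\}$; all arithmetic is over $GF_2$. A completion of $A$ is a $(0,1)$-matrix obtained from $A$ by replacing each $\ast$ by $0$ or $1$; the min-rank of $A$ is the smallest $GF_2$-rank of a completion of $A$. For an $m$-by-$n$ $(0,1,\ast)$-matrix $A=(a_{ij})$, an operator $G=(g_1,\dots,g_m):\{0,1\}^n\to\{0,1\}^m$ is consistent with $A$ if each $g_i$ depends only on the variables $x_j$ with $a_{ij}=\ast$. A set $L\subseteq\{0,1\}^n$ is a solution for $A$ if there exist a completion $M$ of $A$ and an operator $G$ consistent with $A$ such that $M\mathbf{x}=G(\mathbf{x})$ for all $\mathbf{x}\in L$; $\mathrm{opt}(A)$ is the maximum size of a solution for $A$. An $r$-by-$n$ $(0,1,\ast)$-matrix is star-monotone if the sets $S_1,\dots,S_r$ of star positions in its rows (where $S_i=\{j: \text{entry } (i,j)=\ast\}$) form a chain $S_1\subseteq S_2\subseteq\cdots\subseteq S_r$. -}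

module Defs where

open import Data.Bool using (Bool; true; false; _∧_; _xor_)
open import Data.Nat using (ℕ; zero; suc; _≤_)
open import Data.Fin using (Fin; zero; suc)
open import Data.Vec using (Vec; lookup)
open import Data.List using (List; length)
open import Data.List.Membership.Propositional using (_∈_)
open import Data.List.Relation.Unary.Unique.Propositional using (Unique)
open import Data.Product using (Σ; _×_)
open import Data.Unit using (⊤)
open import Relation.Binary.PropositionalEquality using (_≡_)
open import Relation.Nullary using (¬_)
open import Function.Definitions using (Injective)

data Entry : Set where
  𝟎 𝟏 ⋆ : Entry

PMat : ℕ → ℕ → Set
PMat m n = Fin m → Fin n → Entry

BMat : ℕ → ℕ → Set
BMat m n = Fin m → Fin n → Bool

sumB : ∀ {k} → (Fin k → Bool) → Bool
sumB {zero} f = false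
sumB {suc k} f = f zero xor sumB (λ i → f (suc i))

EntryCompl : Entry → Bool → Set
EntryCompl 𝟎 b = b ≡ false
EntryCompl 𝟏 b = b ≡ true
EntryCompl ⋆ b = ⊤

IsCompletion : ∀ {m n} → PMat m n → BMat m n → Set
IsCompletion A M = ∀ i j → EntryCompl (A i j) (M i j)

Independent : ∀ {k n} → (Fin k → Fin n → Bool) → Set
Independent {k} {n} v =
  (c : Fin k → Bool) → (∀ j → sumB (λ i → c i ∧ v i j) ≡ false) → ∀ i → c i ≡ false

RankGE : ∀ {m n} → BMat m n → ℕ → Set
RankGE {m} M k = Σ (Fin k → Fin m) λ σ → Injective _≡_ _≡_ σ × Independent (λ i → M (σ i))

IsRank : ∀ {m n} → BMat m n → ℕ → Set
IsRank M k = RankGE M k × ¬ RankGE M (suc k)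

IsMinRank : ∀ {m n} → PMat m n → ℕ → Set
IsMinRank {m} {n} A k =
  (Σ (BMat m n) λ M → IsCompletion A M × IsRank M k) ×
  (∀ (M : BMat m n) j → IsCompletion A M → IsRank M j → k ≤ j)

Operator : ℕ → ℕ → Set
Operator m n = Vec Bool n → Fin m → Bool

Consistent : ∀ {m n} → PMat m n → Operator m n → Set
Consistent {m} {n} A G =
  ∀ (i : Fin m) (x y : Vec Bool n) →
    (∀ j → A i j ≡ ⋆ → lookup x j ≡ lookup y j) → G x i ≡ G y i

mulMV : ∀ {m n} → BMat m n → Vec Bool n → Fin m → Bool
mulMV M x i = sumB (λ j → M i j ∧ lookup x j)

IsSolution : ∀ {m n} → PMat m n → List (Vec Bool n) → Set
IsSolution {m} {n} A L =
  Unique L ×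
  (Σ (BMat m n) λ M → Σ (Operator m n) λ G →
     IsCompletion A M × Consistent A G ×
     (∀ x → x ∈ L → ∀ i → mulMV M x i ≡ G x i))

OptLE : ∀ {m n} → PMat m n → ℕ → Set
OptLE {m} {n} A b = ∀ (L : List (Vec Bool n)) → IsSolution A L → length L ≤ b

StarMonotone : ∀ {r n} → PMat r n → Set
StarMonotone {r} {n} B =
  ∀ (i i' : Fin r) → Data.Fin._≤_ i i' → ∀ (j : Fin n) → B i j ≡ ⋆ → B i' j ≡ ⋆

module Submission where

-- Let M and G witness a solution L, and let B be the star-monotone submatrix on the rows ρ.
-- Every completion of B has independent rows, so for each row t there is a vector d_t that
-- vanishes on the stars of row t and whose image M d_t is the t-th unit vector on the rows of B:
-- otherwise row t, off its stars, would be a combination of the other rows, and overwriting its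
-- stars accordingly would give a dependent completion. Translation by d_t flips whether x
-- satisfies equation t, and keeps each earlier equation i < t, since G_i only reads the stars of
-- row i and these are stars of row t. Hence each of the r equations halves the set of points
-- satisfying the earlier ones, so at most 2^(n-r) points satisfy all of them; L is among them.

open import Defs
open import Algebra.Bundles using (CommutativeMonoid; CommutativeRing)
import Algebra.Properties.CommutativeSemigroup as CommSemigroupProperties
import Algebra.Properties.Semiring.Sum as SemiringSum
open import Data.Bool using (Bool; true; false; not; _∧_; _xor_; if_then_else_)
import Data.Bool as Bool
open import Data.Bool.Properties
  using ( xor-∧-commutativeRing; ∧-commutativeMonoid; ∧-distribˡ-xor; ∧-distribʳ-xor
        ; ∧-comm; ∧-zeroʳ; ∧-identityʳ; xor-same; xor-identityʳ; xor-comm; not-distribˡ-xor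
        ; not-involutive; ¬-not)
open import Data.Empty using (⊥-elim)
open import Data.Fin using (Fin; zero; suc; toℕ; fromℕ<; punchOut)
  renaming (_<_ to _<ᶠ_)
open import Data.Fin.Properties
  using (any?; ∀-cons; <⇒notInjective; punchOut-injective; <⇒≢; toℕ-fromℕ<)
  renaming (_≟_ to _≟ᶠ_)
import Data.Fin.Permutation as Perm
open import Data.List using (List; []; _∷_; length)
open import Data.List.Membership.Propositional using (_∈_)
open import Data.List.Relation.Unary.All as All using ()
open import Data.List.Relation.Unary.Any using (here; there)
open import Data.List.Relation.Unary.AllPairs using (_∷_)
open import Data.List.Relation.Unary.Unique.Propositional using (Unique)
open import Data.Nat using (ℕ; zero; suc; _+_; _*_; _^_; _∸_; _≤_; _<_; z≤n; s≤s)
open import Data.Nat.Properties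
  using ( +-identityʳ; +-suc; +-comm; +-commutativeSemigroup; *-commutativeSemigroup
        ; *-identityʳ; *-monoˡ-≤; *-cancelˡ-≤; m≤m*n; m^n≢0; m≤n+m; n<1+n; <⇒≤; ≤-refl; ≤-reflexive; ≤-trans
        ; ≤⇒≯; module ≤-Reasoning)
open import Data.Product using (Σ; ∃; _×_; _,_; proj₁; proj₂)
open import Data.Sum using (_⊎_; inj₁; inj₂)
open import Data.Unit using (tt)
open import Data.Vec using (Vec; []; _∷_; lookup; tabulate)
open import Data.Vec.Functional using (head; tail; updateAt)
  renaming (_∷_ to _∷ᶠ_)
open import Data.Vec.Functional.Properties using (updateAt-updates; updateAt-minimal)
open import Data.Vec.Properties using (lookup∘tabulate)
  renaming (≡-dec to ≡-decᵛ)
open import Function using (_∘_; const)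
open import Function.Definitions using (Injective)
open import Relation.Binary.PropositionalEquality
open import Relation.Nullary using (¬_; Dec; yes; no; does)
open import Relation.Nullary.Decidable using (dec-true; decidable-stable)

open CommSemigroupProperties (CommutativeMonoid.commutativeSemigroup ∧-commutativeMonoid)
  using () renaming (x∙yz≈y∙xz to ∧-exchange; x∙yz≈yx∙z to ∧-rotate)

open CommSemigroupProperties +-commutativeSemigroup using () renaming (interchange to +-interchange)

open CommSemigroupProperties *-commutativeSemigroup
  using () renaming (x∙yz≈y∙xz to *-exchange; x∙yz≈yx∙z to *-rotate)

private
  module ∑ = SemiringSum (CommutativeRing.semiring xor-∧-commutativeRing)

sumB≡sum : ∀ {k} (f : Fin k → Bool) → sumB f ≡ ∑.sum f
sumB≡sum {zero}  f = refl
sumB≡sum {suc k} f = cong (f zero xor_) (sumB≡sum (f ∘ suc))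

sumB-cong : ∀ {k} {f g : Fin k → Bool} → (∀ i → f i ≡ g i) → sumB f ≡ sumB g
sumB-cong {zero}  f≗g = refl
sumB-cong {suc k} f≗g = cong₂ _xor_ (f≗g zero) (sumB-cong (f≗g ∘ suc))

sumB-false : ∀ k → sumB {k} (const false) ≡ false
sumB-false zero    = refl
sumB-false (suc k) = sumB-false k

sumB-xor : ∀ {k} (f g : Fin k → Bool) → sumB (λ i → f i xor g i) ≡ sumB f xor sumB g
sumB-xor f g = begin
  sumB (λ i → f i xor g i)  ≡⟨ sumB≡sum (λ i → f i xor g i) ⟩
  ∑.sum (λ i → f i xor g i) ≡⟨ ∑.∑-distrib-+ f g ⟩
  ∑.sum f xor ∑.sum g       ≡⟨ sym (cong₂ _xor_ (sumB≡sum f) (sumB≡sum g)) ⟩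
  sumB f xor sumB g         ∎
  where open ≡-Reasoning

sumB-∧ : ∀ {k} a (f : Fin k → Bool) → sumB (λ i → a ∧ f i) ≡ a ∧ sumB f
sumB-∧ a f = begin
  sumB (λ i → a ∧ f i)  ≡⟨ sumB≡sum (λ i → a ∧ f i) ⟩
  ∑.sum (λ i → a ∧ f i) ≡⟨ sym (∑.*-distribˡ-sum a f) ⟩
  a ∧ ∑.sum f           ≡⟨ cong (a ∧_) (sym (sumB≡sum f)) ⟩
  a ∧ sumB f            ∎
  where open ≡-Reasoning

δ : ∀ {k} → Fin k → Fin k → Bool
δ t i = does (i ≟ᶠ t)

sumB-δ : ∀ {k} (t : Fin k) (f : Fin k → Bool) → sumB (λ i → δ t i ∧ f i) ≡ f t
sumB-δ {suc k} zero    f = trans (cong (f zero xor_) (sumB-false k)) (xor-identityʳ (f zero))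
sumB-δ {suc k} (suc t) f = sumB-δ t (f ∘ suc)

injective⇒surjective : ∀ {k} {σ : Fin k → Fin k} → Injective _≡_ _≡_ σ → ∀ t → ∃ λ i → σ i ≡ t
injective⇒surjective {suc k} {σ} σ-inj t with any? (λ i → σ i ≟ᶠ t)
... | yes hit = hit
... | no  miss = ⊥-elim (<⇒notInjective (n<1+n k) σ′-inj)
  where
  σ≢t : ∀ i → t ≢ σ i
  σ≢t i t≡σi = miss (i , sym t≡σi)
  σ′ : Fin (suc k) → Fin k
  σ′ i = punchOut (σ≢t i)
  σ′-inj : Injective _≡_ _≡_ σ′
  σ′-inj σ′i≡σ′j = σ-inj (punchOut-injective (σ≢t _) (σ≢t _) σ′i≡σ′j)

sumB-permute : ∀ {k} {σ : Fin k → Fin k} → Injective _≡_ _≡_ σ →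
               (f : Fin k → Bool) → sumB (f ∘ σ) ≡ sumB f
sumB-permute {k} {σ} σ-inj f = begin
  sumB (f ∘ σ)  ≡⟨ sumB≡sum (f ∘ σ) ⟩
  ∑.sum (f ∘ σ) ≡⟨ sym (∑.sum-permute f π) ⟩
  ∑.sum f       ≡⟨ sym (sumB≡sum f) ⟩
  sumB f        ∎
  where
  open ≡-Reasoning
  σ⁻¹ : Fin k → Fin k
  σ⁻¹ t = proj₁ (injective⇒surjective σ-inj t)
  σσ⁻¹ : ∀ t → σ (σ⁻¹ t) ≡ t
  σσ⁻¹ t = proj₂ (injective⇒surjective σ-inj t)
  π : Perm.Permutation k k
  π = Perm.permutation σ σ⁻¹ σσ⁻¹ (λ i → σ-inj (σσ⁻¹ (σ i)))

infixl 6 _⊕_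
infixl 7 _⊓_
infix  5 _·_

_⊕_ : ∀ {n} → (Fin n → Bool) → (Fin n → Bool) → Fin n → Bool
(u ⊕ v) j = u j xor v j

_⊓_ : ∀ {n} → (Fin n → Bool) → (Fin n → Bool) → Fin n → Bool
(s ⊓ u) j = s j ∧ u j

_·_ : ∀ {n} → (Fin n → Bool) → (Fin n → Bool) → Bool
u · v = sumB (u ⊓ v)

lincomb : ∀ {k n} → (Fin k → Bool) → (Fin k → Fin n → Bool) → Fin n → Bool
lincomb c U j = sumB (λ i → c i ∧ U i j)

·-distribˡ-⊕ : ∀ {n} (u d e : Fin n → Bool) → u · (d ⊕ e) ≡ (u · d) xor (u · e)
·-distribˡ-⊕ u d e = trans (sumB-cong (λ j → ∧-distribˡ-xor (u j) (d j) (e j))) (sumB-xor (u ⊓ d) (u ⊓ e))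

·-distribʳ-⊕ : ∀ {n} (u v d : Fin n → Bool) → (u ⊕ v) · d ≡ (u · d) xor (v · d)
·-distribʳ-⊕ u v d = trans (sumB-cong (λ j → ∧-distribʳ-xor (d j) (u j) (v j))) (sumB-xor (u ⊓ d) (v ⊓ d))

xor-cancelˡ : ∀ a b → b ≡ a xor (a xor b)
xor-cancelˡ true  b = sym (not-involutive b)
xor-cancelˡ false b = refl

·-⊕-cancelˡ : ∀ {n} (u v d : Fin n → Bool) → v · d ≡ (u · d) xor ((u ⊕ v) · d)
·-⊕-cancelˡ u v d = trans (xor-cancelˡ (u · d) (v · d)) (cong ((u · d) xor_) (sym (·-distribʳ-⊕ u v d)))

·-δ : ∀ {n} (u : Fin n → Bool) j → u · δ j ≡ u j
·-δ u j = trans (sumB-cong (λ i → ∧-comm (u i) (δ j i))) (sumB-δ j u)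

·-⊓ : ∀ {n} (s u d : Fin n → Bool) → u · (s ⊓ d) ≡ (s ⊓ u) · d
·-⊓ s u d = sumB-cong (λ j → ∧-rotate (u j) (s j) (d j))

lincomb-⊕ : ∀ {k n} (a b : Fin k → Bool) (U : Fin k → Fin n → Bool) j →
            lincomb (a ⊕ b) U j ≡ lincomb a U j xor lincomb b U j
lincomb-⊕ a b U j = trans (sumB-cong (λ i → ∧-distribʳ-xor (U i j) (a i) (b i)))
  (sumB-xor (λ i → a i ∧ U i j) (λ i → b i ∧ U i j))

lincomb-δ : ∀ {k n} (t : Fin k) (U : Fin k → Fin n → Bool) j → lincomb (δ t) U j ≡ U t j
lincomb-δ t U j = sumB-δ t (λ i → U i j)

lincomb-⊓ : ∀ {k n} (c : Fin k → Bool) (s : Fin n → Bool) (U : Fin k → Fin n → Bool) j →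
            lincomb c (λ i → s ⊓ U i) j ≡ s j ∧ lincomb c U j
lincomb-⊓ c s U j = trans (sumB-cong (λ i → ∧-exchange (c i) (s j) (U i j))) (sumB-∧ (s j) (λ i → c i ∧ U i j))

InSpan : ∀ {k n} → (Fin k → Fin n → Bool) → (Fin n → Bool) → Set
InSpan U v = Σ _ λ c → ∀ j → lincomb c U j ≡ v j

Separator : ∀ {k n} → (Fin k → Fin n → Bool) → (Fin n → Bool) → (Fin n → Bool) → Set
Separator U v d = (∀ i → U i · d ≡ false) × v · d ≡ true

separator-cons : ∀ {k n} (U : Fin (suc k) → Fin n → Bool) (v : Fin n → Bool) {d d′} →
                 Separator (tail U) v d → Separator (tail U) (head U ⊕ v) d′ → ∃ (Separator U v)
separator-cons U v {d} {d′} (U⊥d , v·d) (U⊥d′ , w·d′) with head U · d in e | head U · d′ in e′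
... | false | _     = d , ∀-cons e U⊥d , v·d
... | true  | false = d′ , ∀-cons e′ U⊥d′ , trans (·-⊕-cancelˡ (head U) v d′) (cong₂ _xor_ e′ w·d′)
... | true  | true  = d ⊕ d′ , ∀-cons (kills e e′) (λ i → kills (U⊥d i) (U⊥d′ i)) , v·d⊕d′
  where
  kills : ∀ {u a} → u · d ≡ a → u · d′ ≡ a → u · (d ⊕ d′) ≡ false
  kills {u} {a} u·d u·d′ = trans (·-distribˡ-⊕ u d d′) (trans (cong₂ _xor_ u·d u·d′) (xor-same a))
  v·d⊕d′ : v · (d ⊕ d′) ≡ true
  v·d⊕d′ = trans (·-distribˡ-⊕ v d d′)
             (cong₂ _xor_ v·d (trans (·-⊕-cancelˡ (head U) v d′) (cong₂ _xor_ e′ w·d′)))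

-- Induction on the rows: v lies in the span of U iff v or head U ⊕ v lies in the span of tail U.
span-or-separator : ∀ {k n} (U : Fin k → Fin n → Bool) (v : Fin n → Bool) →
                    InSpan U v ⊎ ∃ (Separator U v)
span-or-separator {zero} U v with any? (λ j → v j Bool.≟ true)
... | yes (j , vⱼ) = inj₂ (δ j , (λ ()) , trans (·-δ v j) vⱼ)
... | no  v≡0      = inj₁ ((λ ()) , λ j → sym (¬-not (v≡0 ∘ (j ,_))))
span-or-separator {suc k} U v
  with span-or-separator (tail U) v | span-or-separator (tail U) (head U ⊕ v)
... | inj₁ (c , spans) | _ = inj₁ (false ∷ᶠ c , spans)
... | _ | inj₁ (c , spans) =
  inj₁ (true ∷ᶠ c , λ j → trans (cong (head U j xor_) (spans j)) (sym (xor-cancelˡ (head U j) (v j))))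
... | inj₂ (_ , sep) | inj₂ (_ , sep′) = inj₂ (separator-cons U v sep sep′)

full-rank⇒independent : ∀ {r n} {N : BMat r n} → RankGE N r → Independent N
full-rank⇒independent {N = N} (σ , σ-inj , σ-indep) c c-kills i
  with k , σk≡i ← injective⇒surjective σ-inj i =
  trans (cong c (sym σk≡i))
        (σ-indep (c ∘ σ) (λ j → trans (sumB-permute σ-inj (λ i → c i ∧ N i j)) (c-kills j)) k)

rank-zero : ∀ {m n} (N : BMat m n) → RankGE N 0
rank-zero N = (λ ()) , (λ {i} → λ { {()} }) , (λ c c-kills ())

-- Climbing from j towards k, the first failure of RankGE would be an exact rank below k.
no-rank-below : ∀ {m n} {N : BMat m n} {k} → (∀ j → IsRank N j → k ≤ j) → ¬ RankGE N k →
                ∀ s j → s + j ≡ k → ¬ RankGE N j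
no-rank-below k≤rank ¬Rₖ zero    j refl = ¬Rₖ
no-rank-below {N = N} k≤rank ¬Rₖ (suc s) j s+j≡k Rⱼ =
  ≤⇒≯ (k≤rank j (Rⱼ , no-rank-below {N = N} k≤rank ¬Rₖ s (suc j) (trans (+-suc s j) s+j≡k)))
      (subst (j <_) s+j≡k (s≤s (m≤n+m j s)))

minRank⇒independent : ∀ {r n} {B : PMat r n} → IsMinRank B r →
                      ∀ {N} → IsCompletion B N → Independent N
minRank⇒independent {r} (_ , r≤rank) {N} N-compl c c-kills i =
  decidable-stable (c i Bool.≟ false) λ cᵢ≢false →
    no-rank-below {N = N} (λ j → r≤rank N j N-compl) (λ Rᵣ → cᵢ≢false (full-rank⇒independent Rᵣ c c-kills i))
                  r 0 (+-identityʳ r) (rank-zero N)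

-- Isolating a row of a min-rank matrix

true≢false : true ≢ false
true≢false ()

isFixed : Entry → Bool
isFixed ⋆ = false
isFixed 𝟎 = true
isFixed 𝟏 = true

entryCompl-fixed : ∀ e {b b′} → EntryCompl e b → isFixed e ∧ b′ ≡ isFixed e ∧ b → EntryCompl e b′
entryCompl-fixed 𝟎 compl b′≡b = trans b′≡b compl
entryCompl-fixed 𝟏 compl b′≡b = trans b′≡b compl
entryCompl-fixed ⋆ _     _    = tt

record Isolator {r n} (B : PMat r n) (N : BMat r n) (t : Fin r) : Set where
  field
    vector       : Fin n → Bool
    off-stars    : ∀ j → B t j ≡ ⋆ → vector j ≡ false
    kills-others : ∀ i → i ≢ t → N i · vector ≡ false
    hits-row     : N t · vector ≡ true

module _ {r n} (B : PMat r n) (N : BMat r n) (t : Fin r) where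

  fixedCols : Fin n → Bool
  fixedCols j = isFixed (B t j)

  otherRows : BMat r n
  otherRows = updateAt N t (const (const false))

  isolator-of-separator : ∀ {d} → Separator (λ i → fixedCols ⊓ otherRows i) (fixedCols ⊓ N t) d →
                          Isolator B N t
  isolator-of-separator {d} (others⊥d , Nₜ·d) = record
    { vector       = fixedCols ⊓ d
    ; off-stars    = λ j ⋆≡ → cong (λ e → isFixed e ∧ d j) ⋆≡
    ; kills-others = λ i i≢t → begin
        N i · (fixedCols ⊓ d)         ≡⟨ ·-⊓ fixedCols (N i) d ⟩
        (fixedCols ⊓ N i) · d         ≡⟨ cong (λ u → (fixedCols ⊓ u) · d) (updateAt-minimal i t N i≢t) ⟨
        (fixedCols ⊓ otherRows i) · d ≡⟨ others⊥d i ⟩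
        false                         ∎
    ; hits-row     = trans (·-⊓ fixedCols (N t) d) Nₜ·d
    }
    where open ≡-Reasoning

  -- Row t may be replaced by the combination of the other rows that agrees with it
  -- off its stars, which yields a dependent completion.
  dependent-completion-of-span : IsCompletion B N → InSpan (λ i → fixedCols ⊓ otherRows i) (fixedCols ⊓ N t) →
                                 Σ (BMat r n) λ N′ → IsCompletion B N′ × ¬ Independent N′
  dependent-completion-of-span N-compl (c , spans) = N′ , N′-compl , N′-dependent
    where
    w : Fin n → Bool
    w = lincomb c otherRows

    w-fixed : ∀ j → fixedCols j ∧ w j ≡ fixedCols j ∧ N t j
    w-fixed j = trans (sym (lincomb-⊓ c fixedCols otherRows j)) (spans j)

    N′ : BMat r n
    N′ = updateAt N t (const w)

    N′-compl : IsCompletion B N′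
    N′-compl i j with i ≟ᶠ t
    ... | yes refl = subst (EntryCompl (B t j)) (sym (cong-app (updateAt-updates t N) j))
                       (entryCompl-fixed (B t j) (N-compl t j) (w-fixed j))
    ... | no  i≢t  = subst (EntryCompl (B i j)) (sym (cong-app (updateAt-minimal i t N i≢t) j))
                       (N-compl i j)

    c′ : Fin r → Bool
    c′ = updateAt c t (const false)

    same-combination : ∀ j i → c′ i ∧ N′ i j ≡ c i ∧ otherRows i j
    same-combination j i with i ≟ᶠ t
    ... | yes refl = begin
      c′ t ∧ N′ t j        ≡⟨ cong (_∧ N′ t j) (updateAt-updates t c) ⟩
      false                ≡⟨ ∧-zeroʳ (c t) ⟨
      c t ∧ false          ≡⟨ cong (c t ∧_) (cong-app (updateAt-updates t N) j) ⟨
      c t ∧ otherRows t j  ∎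
      where open ≡-Reasoning
    ... | no  i≢t  = cong₂ (λ a u → a ∧ u j) (updateAt-minimal i t c i≢t)
                           (trans (updateAt-minimal i t N i≢t) (sym (updateAt-minimal i t N i≢t)))

    N′-dependent : ¬ Independent N′
    N′-dependent N′-indep = true≢false (trans (sym eₜ) (N′-indep e e-kills t))
      where
      e : Fin r → Bool
      e = c′ ⊕ δ t
      eₜ : e t ≡ true
      eₜ = cong₂ _xor_ (updateAt-updates t c) (dec-true (t ≟ᶠ t) refl)
      e-kills : ∀ j → lincomb e N′ j ≡ false
      e-kills j = begin
        lincomb e N′ j                         ≡⟨ lincomb-⊕ c′ (δ t) N′ j ⟩
        lincomb c′ N′ j xor lincomb (δ t) N′ j ≡⟨ cong₂ _xor_ (sumB-cong (same-combination j)) (lincomb-δ t N′ j) ⟩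
        w j xor N′ t j                         ≡⟨ cong (λ u → w j xor u j) (updateAt-updates t N) ⟩
        w j xor w j                            ≡⟨ xor-same (w j) ⟩
        false                                  ∎
        where open ≡-Reasoning

  isolator : (∀ {N′} → IsCompletion B N′ → Independent N′) → IsCompletion B N → Isolator B N t
  isolator independent N-compl
    with span-or-separator (λ i → fixedCols ⊓ otherRows i) (fixedCols ⊓ N t)
  ... | inj₂ (_ , separates) = isolator-of-separator separates
  ... | inj₁ spans with N′ , N′-compl , N′-dependent ← dependent-completion-of-span N-compl spans =
    ⊥-elim (N′-dependent (independent N′-compl))

-- Counting points of the cube

count : ∀ {n} → (Vec Bool n → Bool) → ℕ
count {zero}  f = if f [] then 1 else 0
count {suc n} f = count (f ∘ (true ∷_)) + count (f ∘ (false ∷_))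

count-cong : ∀ {n} {f g : Vec Bool n → Bool} → (∀ x → f x ≡ g x) → count f ≡ count g
count-cong {zero}  f≗g = cong (if_then 1 else 0) (f≗g [])
count-cong {suc n} f≗g = cong₂ _+_ (count-cong (f≗g ∘ (true ∷_))) (count-cong (f≗g ∘ (false ∷_)))

count-true : ∀ n → count {n} (const true) ≡ 2 ^ n
count-true zero    = refl
count-true (suc n) = cong₂ _+_ (count-true n) (trans (count-true n) (sym (+-identityʳ (2 ^ n))))

count-false : ∀ n → count {n} (const false) ≡ 0
count-false zero    = refl
count-false (suc n) = cong₂ _+_ (count-false n) (count-false n)

count-split : ∀ {n} (f g : Vec Bool n → Bool) →
              count f ≡ count (λ x → f x ∧ g x) + count (λ x → f x ∧ not (g x))
count-split {zero} f g with f [] | g []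
... | false | _     = refl
... | true  | true  = refl
... | true  | false = refl
count-split {suc n} f g =
  trans (cong₂ _+_ (count-split (f ∘ (true ∷_)) (g ∘ (true ∷_))) (count-split (f ∘ (false ∷_)) (g ∘ (false ∷_))))
        (+-interchange (count (λ x → f (true ∷ x) ∧ g (true ∷ x))) _ _ _)

shift : ∀ {n} → (Fin n → Bool) → Vec Bool n → Vec Bool n
shift d x = tabulate (λ j → lookup x j xor d j)

count-shift : ∀ {n} (f : Vec Bool n → Bool) (d : Fin n → Bool) → count f ≡ count (f ∘ shift d)
count-shift {zero}  f d = refl
count-shift {suc n} f d with d zero
... | false = cong₂ _+_ (count-shift (f ∘ (true ∷_)) (d ∘ suc)) (count-shift (f ∘ (false ∷_)) (d ∘ suc))
... | true  = trans (+-comm (count (f ∘ (true ∷_))) _)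
                    (cong₂ _+_ (count-shift (f ∘ (false ∷_)) (d ∘ suc)) (count-shift (f ∘ (true ∷_)) (d ∘ suc)))

-- Translation by d maps the points of f ∧ g bijectively onto those of f ∧ not g.
count-halves : ∀ {n} (f g : Vec Bool n → Bool) (d : Fin n → Bool) →
               (∀ x → f (shift d x) ≡ f x) → (∀ x → g (shift d x) ≡ not (g x)) →
               2 * count (λ x → f x ∧ g x) ≡ count f
count-halves {n} f g d f-inv g-flips = begin
  2 * count f∧g                                ≡⟨ cong (count f∧g +_) (+-identityʳ (count f∧g)) ⟩
  count f∧g + count f∧g                        ≡⟨ cong (count f∧g +_) (count-shift f∧g d) ⟩
  count f∧g + count (f∧g ∘ shift d)            ≡⟨ cong (count f∧g +_) (count-cong translated) ⟩
  count f∧g + count (λ x → f x ∧ not (g x))    ≡⟨ count-split f g ⟨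
  count f                                      ∎
  where
  open ≡-Reasoning
  f∧g : Vec Bool n → Bool
  f∧g x = f x ∧ g x
  translated : ∀ x → f∧g (shift d x) ≡ f x ∧ not (g x)
  translated x = cong₂ _∧_ (f-inv x) (g-flips x)

_≟ᵛ_ : ∀ {n} (x y : Vec Bool n) → Dec (x ≡ y)
_≟ᵛ_ = ≡-decᵛ Bool._≟_

count-≡ : ∀ {n} (x : Vec Bool n) → count (λ y → does (y ≟ᵛ x)) ≡ 1
count-≡ []                  = refl
count-≡ {suc n} (true  ∷ x) = cong₂ _+_ (count-≡ x) (count-false n)
count-≡ {suc n} (false ∷ x) = cong₂ _+_ (count-false n) (count-≡ x)

unique⇒length≤count : ∀ {n} (f : Vec Bool n → Bool) (L : List (Vec Bool n)) → Unique L →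
                      (∀ x → x ∈ L → f x ≡ true) → length L ≤ count f
unique⇒length≤count f []      _              _   = z≤n
unique⇒length≤count {n} f (x ∷ L) (x∉L ∷ L-uniq) f-L = begin
  suc (length L)                          ≤⟨ s≤s (unique⇒length≤count f′ L L-uniq f′-L) ⟩
  1 + count f′                            ≡⟨ cong (_+ count f′) (trans (count-cong f∧≡x) (count-≡ x)) ⟨
  count (λ y → f y ∧ (y ≡ᵇ x)) + count f′ ≡⟨ count-split f (_≡ᵇ x) ⟨
  count f                                 ∎
  where
  open ≤-Reasoning
  _≡ᵇ_ : Vec Bool n → Vec Bool n → Bool
  y ≡ᵇ x′ = does (y ≟ᵛ x′)
  f′ : Vec Bool n → Bool
  f′ y = f y ∧ not (y ≡ᵇ x)
  f′-L : ∀ y → y ∈ L → f′ y ≡ true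
  f′-L y y∈L with y ≟ᵛ x
  ... | yes refl = ⊥-elim (All.lookup x∉L y∈L refl)
  ... | no  _    = trans (∧-identityʳ (f y)) (f-L y (there y∈L))
  f∧≡x : ∀ y → f y ∧ (y ≡ᵇ x) ≡ (y ≡ᵇ x)
  f∧≡x y with y ≟ᵛ x
  ... | yes refl = trans (∧-identityʳ (f x)) (f-L x (here refl))
  ... | no  _    = ∧-zeroʳ (f y)

module Triangular {r n} (g : Fin r → Vec Bool n → Bool) (d : Fin r → Fin n → Bool)
  (flips : ∀ t x → g t (shift (d t) x) ≡ not (g t x))
  (keeps : ∀ {i t} → i <ᶠ t → ∀ x → g i (shift (d t) x) ≡ g i x) where

  allBefore : (k : ℕ) → k ≤ r → Vec Bool n → Bool
  allBefore zero    _   x = true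
  allBefore (suc k) k<r x = allBefore k (<⇒≤ k<r) x ∧ g (fromℕ< k<r) x

  allBefore-shift : ∀ k (k≤r : k ≤ r) t → k ≤ toℕ t → ∀ x →
                    allBefore k k≤r (shift (d t) x) ≡ allBefore k k≤r x
  allBefore-shift zero    _   t _   x = refl
  allBefore-shift (suc k) k<r t k<t x =
    cong₂ _∧_ (allBefore-shift k (<⇒≤ k<r) t (<⇒≤ k<t) x)
              (keeps (subst (_< toℕ t) (sym (toℕ-fromℕ< k<r)) k<t) x)

  allBefore-true : ∀ k (k≤r : k ≤ r) x → (∀ i → g i x ≡ true) → allBefore k k≤r x ≡ true
  allBefore-true zero    _   x g≡true = refl
  allBefore-true (suc k) k<r x g≡true = cong₂ _∧_ (allBefore-true k (<⇒≤ k<r) x g≡true) (g≡true (fromℕ< k<r))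

  count-allBefore : ∀ k (k≤r : k ≤ r) → count (allBefore k k≤r) * 2 ^ k ≡ 2 ^ n
  count-allBefore zero    _   = trans (*-identityʳ _) (count-true n)
  count-allBefore (suc k) k<r = begin
    count (allBefore (suc k) k<r) * (2 * 2 ^ k) ≡⟨ *-rotate (count (allBefore (suc k) k<r)) 2 (2 ^ k) ⟩
    2 * count (allBefore (suc k) k<r) * 2 ^ k   ≡⟨ cong (_* 2 ^ k) halves ⟩
    count (allBefore k k≤r) * 2 ^ k             ≡⟨ count-allBefore k k≤r ⟩
    2 ^ n                                       ∎
    where
    open ≡-Reasoning
    k≤r : k ≤ r
    k≤r = <⇒≤ k<r
    t : Fin r
    t = fromℕ< k<r
    halves : 2 * count (allBefore (suc k) k<r) ≡ count (allBefore k k≤r)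
    halves = count-halves (allBefore k k≤r) (g t) (d t)
               (allBefore-shift k k≤r t (≤-reflexive (sym (toℕ-fromℕ< k<r)))) (flips t)

m*2^k≤2^n⇒m≤2^[n∸k] : ∀ k n c → c * 2 ^ k ≤ 2 ^ n → c ≤ 2 ^ (n ∸ k)
m*2^k≤2^n⇒m≤2^[n∸k] zero    n       c c*1≤2ⁿ = subst (_≤ 2 ^ n) (*-identityʳ c) c*1≤2ⁿ
m*2^k≤2^n⇒m≤2^[n∸k] (suc k) zero    c c*2ᵏ≤1 = ≤-trans (m≤m*n c (2 ^ suc k) {{m^n≢0 2 (suc k)}}) c*2ᵏ≤1
m*2^k≤2^n⇒m≤2^[n∸k] (suc k) (suc n) c c*2ᵏ≤2ⁿ =
  m*2^k≤2^n⇒m≤2^[n∸k] k n c (*-cancelˡ-≤ 2 (subst (_≤ 2 * 2 ^ n) (*-exchange c 2 (2 ^ k)) c*2ᵏ≤2ⁿ))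

agrees : ∀ {m n} → BMat m n → Operator m n → Fin m → Vec Bool n → Bool
agrees M G i x = not (mulMV M x i xor G x i)

agrees-shift : ∀ {m n} {A : PMat m n} {M : BMat m n} {G : Operator m n} → Consistent A G →
               ∀ i d → (∀ j → A i j ≡ ⋆ → d j ≡ false) →
               ∀ x → agrees M G i (shift d x) ≡ agrees M G i x xor (M i · d)
agrees-shift {M = M} {G} G-consistent i d d-off-stars x = begin
  not (mulMV M (shift d x) i xor G (shift d x) i)  ≡⟨ cong₂ (λ a b → not (a xor b)) Mx⊕d Gx⊕d ⟩
  not ((mulMV M x i xor (M i · d)) xor G x i)      ≡⟨ cong not (xor-swap (mulMV M x i) _ _) ⟩
  not ((mulMV M x i xor G x i) xor (M i · d))      ≡⟨ not-distribˡ-xor (mulMV M x i xor G x i) (M i · d) ⟩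
  agrees M G i x xor (M i · d)                     ∎
  where
  open ≡-Reasoning
  open CommSemigroupProperties (CommutativeRing.+-commutativeSemigroup xor-∧-commutativeRing)
    using () renaming (xy∙z≈xz∙y to xor-swap)
  lookup-shift : ∀ j → lookup (shift d x) j ≡ lookup x j xor d j
  lookup-shift = lookup∘tabulate _
  Mx⊕d : mulMV M (shift d x) i ≡ mulMV M x i xor (M i · d)
  Mx⊕d = trans (sumB-cong (λ j → cong (M i j ∧_) (lookup-shift j))) (·-distribˡ-⊕ (M i) (lookup x) d)
  Gx⊕d : G (shift d x) i ≡ G x i
  Gx⊕d = G-consistent i (shift d x) x λ j ⋆≡ →
           trans (lookup-shift j) (trans (cong (lookup x j xor_) (d-off-stars j ⋆≡)) (xor-identityʳ _))

module Agreement {m n r} {A : PMat m n} {ρ : Fin r → Fin m} {M : BMat m n} {G : Operator m n}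
  (monotone : StarMonotone (λ i j → A (ρ i) j)) (minRank : IsMinRank (λ i j → A (ρ i) j) r)
  (M-compl : IsCompletion A M) (G-consistent : Consistent A G) where

  isolate : (t : Fin r) → Isolator (λ i j → A (ρ i) j) (λ i → M (ρ i)) t
  isolate t = isolator _ _ t (minRank⇒independent minRank) (λ i → M-compl (ρ i))

  isolating : Fin r → Fin n → Bool
  isolating t = Isolator.vector (isolate t)

  agreeing : Fin r → Vec Bool n → Bool
  agreeing i = agrees M G (ρ i)

  agreeing-flips : ∀ t x → agreeing t (shift (isolating t) x) ≡ not (agreeing t x)
  agreeing-flips t x = trans (agrees-shift {M = M} G-consistent (ρ t) _ off-stars x)
                             (trans (cong (agreeing t x xor_) hits-row) (xor-comm _ true))
    where open Isolator (isolate t)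

  -- Here star-monotonicity is used: isolating t vanishes on the stars of every earlier row.
  agreeing-keeps : ∀ {i t} → i <ᶠ t → ∀ x → agreeing i (shift (isolating t) x) ≡ agreeing i x
  agreeing-keeps {i} {t} i<t x =
    trans (agrees-shift {M = M} G-consistent (ρ i) _ (λ j ⋆≡ → off-stars j (monotone i t (<⇒≤ i<t) j ⋆≡)) x)
          (trans (cong (agreeing i x xor_) (kills-others i (<⇒≢ i<t))) (xor-identityʳ _))
    where open Isolator (isolate t)

  agreeing-solution : ∀ x → (∀ i → mulMV M x i ≡ G x i) → ∀ i → agreeing i x ≡ true
  agreeing-solution x Mx≡Gx i =
    trans (cong (λ a → not (a xor G x (ρ i))) (Mx≡Gx (ρ i))) (cong not (xor-same (G x (ρ i))))

-- The rows picked by ρ need not be distinct for the argument.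
theorem2 : ∀ {m n r : ℕ} (A : PMat m n) (ρ : Fin r → Fin m) →
    Injective _≡_ _≡_ ρ →
    StarMonotone (λ i j → A (ρ i) j) →
    IsMinRank (λ i j → A (ρ i) j) r →
    OptLE A (2 ^ (n ∸ r))
theorem2 {n = n} {r} A ρ _ monotone minRank L (L-unique , M , G , M-compl , G-consistent , L-solves) =
  m*2^k≤2^n⇒m≤2^[n∸k] r n (length L) (begin
    length L * 2 ^ r                   ≤⟨ *-monoˡ-≤ (2 ^ r) (unique⇒length≤count _ L L-unique L-agrees) ⟩
    count (allBefore r ≤-refl) * 2 ^ r ≡⟨ count-allBefore r ≤-refl ⟩
    2 ^ n                              ∎)
  where
  open ≤-Reasoning
  open Agreement monotone minRank M-compl G-consistent
  open Triangular agreeing isolating agreeing-flips agreeing-keeps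
  L-agrees : ∀ x → x ∈ L → allBefore r ≤-refl x ≡ true
  L-agrees x x∈L = allBefore-true r ≤-refl x (agreeing-solution x (L-solves x x∈L))
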